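{- Let $A=\langle S,\Sigma,E,s_0\rangle$ and $A'=\langle S',\Sigma_{\mathcal{F}},E',s_0'\rangle$ be transition systems. Then $A\preceq_m A'$ if and only if the verifier has a winning strategy in the strong masking game graph $\mathcal{G}_{A^M,A'}$.
   Context: A transition system is a tuple $\langle S,\Sigma,E,s_0\rangle$ with $S$ finite, $\Sigma$ a finite alphabet, $E\subseteq S\times\Sigma\times S$ (written $s\xrightarrow{e}t$), $s_0\in S$; every state has at least one outgoing transition. $\mathcal{F}=\{F_0,\dots,F_n\}$ is a finite set of fault labels disjoint from $\Sigma$, $\Sigma_{\mathcal{F}}=\Sigma\cup\mathcal{F}$; $M\notin\Sigma\cup\mathcal{F}$ is a masking label, and $A^M$ is $A$ with alphabet $\Sigma\cup\{M\}$ and an added self-loop $s\xrightarrow{M}s$ at every state. Strong masking simulation: $A\preceq_m A'$ iff there is $\mathcal{M}\subseteq S\times S'$ with (A) $s_0\,\mathcal{M}\,s_0'$, and (B) for all $s\,\mathcal{M}\,s'$ and $e\in\Sigma$: (1) if $s\xrightarrow{e}t$ then some $s'\xrightarrow{e}t'$ with $t\,\mathcal{M}\,t'$; (2) if $s'\xrightarrow{e}t'$ then some $s\xrightarrow{e}t$ with $t\,\mathcal{M}\,t'$; (3) if $s'\xrightarrow{F}t'$ for some $F\in\mathcal{F}$ then some $s\xrightarrow{M}t$ in $A^M$ with $t\,\mathcal{M}\,t'$. Strong masking game graph $\mathcal{G}_{A^M,A'}$: a two-player (refuter $R$, verifier $V$) graph. Refuter nodes are $(s,\#,s',R)$ for $s\in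 S,s'\in S'$, plus an error node $s_{err}$; verifier nodes are $(s,\sigma^k,s',V)$ with $s\in S$, $s'\in S'$, $k\in\{1,2\}$, $\sigma$ a label (the superscript records whether the refuter moved in $A$ ($k=1$) or $A'$ ($k=2$)). Initial node $(s_0,\#,s_0',R)$. Labelled edges: $(s,\#,s',R)\xrightarrow{\sigma}(t,\sigma^1,s',V)$ if $\sigma\in\Sigma$ and $s\xrightarrow{\sigma}t$ in $A$; $(s,\#,s',R)\xrightarrow{\sigma}(s,\sigma^2,t',V)$ if $\sigma\in\Sigma_{\mathcal{F}}$ and $s'\xrightarrow{\sigma}t'$ in $A'$; $(s,\sigma^2,s',V)\xrightarrow{\sigma}(t,\#,s',R)$ if $\sigma\in\Sigma$ and $s\xrightarrow{\sigma}t$ in $A$; $(s,\sigma^1,s',V)\xrightarrow{\sigma}(s,\#,t',R)$ if $\sigma\in\Sigma$ and $s'\xrightarrow{\sigma}t'$ in $A'$; $(s,F^2,s',V)\xrightarrow{M}(t,\#,s',R)$ if $F\in\mathcal{F}$ and $s\xrightarrow{M}t$ in $A^M$; finally every node with no outgoing edge gets edges to $s_{err}$, and $s_{err}$ gets self-loops (labels in $\Sigma$). A play is an infinite path from the initial node; a strategy for a player maps each finite play prefix ending in one of that player's nodes to an outgoing edge of that node. The refuter wins a play iff it visits $s_{err}$, otherwise the verifier wins; a winning strategy for a player is one all of whose conforming plays are won by that player. -}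

module Defs where

open import Data.Nat using (ℕ; zero; suc)
open import Data.Fin using (Fin; _≟_)
open import Data.Bool using (Bool; true)
open import Data.Sum using (_⊎_; inj₁; inj₂)
open import Data.Unit using (⊤; tt)
open import Data.Empty using (⊥)
open import Data.Product using (Σ; _×_; _,_; proj₁; proj₂)
open import Relation.Nullary using (¬_; does)
open import Relation.Binary.PropositionalEquality using (_≡_; refl; subst; sym)

record TS (L : Set) : Set where
  field
    size  : ℕ
    trans : Fin size → L → Fin size → Bool
    init  : Fin size
    total : ∀ s → Σ L λ e → Σ (Fin size) λ t → trans s e t ≡ true

State : {L : Set} → TS L → Set
State T = Fin (TS.size T)

Step : {L : Set} (T : TS L) → State T → L → State T → Set
Step T s e t = TS.trans T s e t ≡ true

-- Σ = Fin k, faults 𝓕 = Fin f, Σ_𝓕 = Fin k ⊎ Fin f.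
-- A^M has alphabet Σ ∪ {M} = Fin k ⊎ ⊤ (M = inj₂ tt), with an added
-- M-self-loop at every state.

Mlab : {k : ℕ} → Fin k ⊎ ⊤
Mlab = inj₂ tt

_ᴹ : {k : ℕ} → TS (Fin k) → TS (Fin k ⊎ ⊤)
_ᴹ {k} A = record
  { size  = TS.size A
  ; trans = tr
  ; init  = TS.init A
  ; total = tot
  }
  where
  tr : Fin (TS.size A) → Fin k ⊎ ⊤ → Fin (TS.size A) → Bool
  tr s (inj₁ e) t = TS.trans A s e t
  tr s (inj₂ _) t = does (s ≟ t)
  tot : ∀ s → Σ (Fin k ⊎ ⊤) λ e → Σ (Fin (TS.size A)) λ t → tr s e t ≡ true
  tot s with TS.total A s
  ... | e , t , p = inj₁ e , t , p

MaskingSimRel : {k f : ℕ} (A : TS (Fin k)) (A' : TS (Fin k ⊎ Fin f)) →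
                (State A → State A' → Set) → Set
MaskingSimRel {k} {f} A A' R =
  R (TS.init A) (TS.init A') ×
  (∀ s s' → R s s' →
    (∀ (e : Fin k) t → Step A s e t →
        Σ (State A') λ t' → Step A' s' (inj₁ e) t' × R t t') ×
    (∀ (e : Fin k) t' → Step A' s' (inj₁ e) t' →
        Σ (State A) λ t → Step A s e t × R t t') ×
    (∀ (F : Fin f) t' → Step A' s' (inj₂ F) t' →
        Σ (State (A ᴹ)) λ t → Step (A ᴹ) s Mlab t × R t t'))

_⪯ₘ_ : {k f : ℕ} (A : TS (Fin k)) (A' : TS (Fin k ⊎ Fin f)) → Set₁
A ⪯ₘ A' = Σ (State A → State A' → Set) λ R → MaskingSimRel A A' R

data Side : Set where
  one two : Side        -- superscript k ∈ {1,2}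

module MaskingGame {k f : ℕ} (A : TS (Fin k)) (A' : TS (Fin k ⊎ Fin f)) where

  data GLabel : Set where
    lab  : Fin k ⊎ Fin f → GLabel
    mask : GLabel

  data Node : Set where
    rN  : State A → State A' → Node                        -- (s,#,s',R)
    vN  : State A → (Fin k ⊎ Fin f) → Side → State A' → Node -- (s,σ^k,s',V)
    err : Node

  initNode : Node
  initNode = rN (TS.init A) (TS.init A')

  IsVerifier : Node → Set
  IsVerifier (rN _ _)     = ⊥
  IsVerifier (vN _ _ _ _) = ⊤
  IsVerifier err          = ⊥

  data BaseEdge : Node → GLabel → Node → Set where
    r1 : ∀ {s s' e t} → Step A s e t →
         BaseEdge (rN s s') (lab (inj₁ e)) (vN t (inj₁ e) one s')
    r2 : ∀ {s s' σ t'} → Step A' s' σ t' →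
         BaseEdge (rN s s') (lab σ) (vN s σ two t')
    v2 : ∀ {s s' e t} → Step A s e t →
         BaseEdge (vN s (inj₁ e) two s') (lab (inj₁ e)) (rN t s')
    v1 : ∀ {s s' e t'} → Step A' s' (inj₁ e) t' →
         BaseEdge (vN s (inj₁ e) one s') (lab (inj₁ e)) (rN s t')
    vM : ∀ {s s' F t} → Step (A ᴹ) s Mlab t →
         BaseEdge (vN s (inj₂ F) two s') mask (rN t s')

  -- every node without outgoing edge (including s_err itself) gets
  -- edges to s_err labelled by letters of Σ; this yields the Σ-labelled
  -- self-loops of s_err.
  Edge : Node → GLabel → Node → Set
  Edge n l m =
    BaseEdge n l m ⊎
    ((∀ l' m' → ¬ BaseEdge n l' m') × m ≡ err × Σ (Fin k) λ e → l ≡ lab (inj₁ e))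

  data Prefix : Node → Set where
    start : Prefix initNode
    step  : ∀ {n l m} → Prefix n → Edge n l m → Prefix m

  record Play : Set where
    field
      node  : ℕ → Node
      label : ℕ → GLabel
      first : node 0 ≡ initNode
      edge  : ∀ i → Edge (node i) (label i) (node (suc i))

  prefixOf : (P : Play) → (i : ℕ) → Prefix (Play.node P i)
  prefixOf P zero    = subst Prefix (sym (Play.first P)) start
  prefixOf P (suc i) = step (prefixOf P i) (Play.edge P i)

  VStrategy : Set
  VStrategy = ∀ {n} → Prefix n → IsVerifier n →
              Σ GLabel λ l → Σ Node λ m → Edge n l m

  ConformsTo : VStrategy → Play → Set
  ConformsTo σ P = ∀ i → (v : IsVerifier (Play.node P i)) →
    proj₁ (σ (prefixOf P i) v) ≡ Play.label P i ×
    proj₁ (proj₂ (σ (prefixOf P i) v)) ≡ Play.node P (suc i)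

  VerifierWinsPlay : Play → Set
  VerifierWinsPlay P = ∀ i → ¬ (Play.node P i ≡ err)

  WinningV : VStrategy → Set
  WinningV σ = ∀ P → ConformsTo σ P → VerifierWinsPlay P

  VerifierHasWinningStrategy : Set
  VerifierHasWinningStrategy = Σ VStrategy WinningV

VerifierWins : {k f : ℕ} (A : TS (Fin k)) (A' : TS (Fin k ⊎ Fin f)) → Set
VerifierWins A A' = MaskingGame.VerifierHasWinningStrategy A A'

module Submission where

-- The game graph has no dead ends (lemma outgoing): every node has an edge,
-- possibly one into s_err.  This gives both directions a default move.
--
-- (⇒) Given a masking simulation R, the verifier tracks along the play a
-- piece of evidence: R s s' at a refuter node (s,#,s',R), and at a verifier
-- node an answer given by the clauses (B1)-(B3) that leads back into R.  The
-- strategy plays the tracked answer.  Along a conforming play the evidence is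
-- never lost, and nothing can be tracked at s_err, so s_err is never visited.
--
-- (⇐) Given a winning strategy σ, relate s and s' when (s,#,s',R) ends some
-- prefix reachable under σ.  Any reachable prefix extends to a conforming
-- play (replay it, then continue with σ), so no reachable prefix ends in
-- s_err; hence σ always answers a refuter move with a genuine edge of the
-- game, which is exactly what clauses (B1)-(B3) ask for.

open import Defs
open import Data.Nat using (ℕ; zero; suc)
open import Data.Nat.GeneralisedArithmetic using (fold; iterate; iterate-is-fold)
open import Data.Fin using (Fin; _≟_)
open import Data.Fin.Properties using (any?)
open import Data.Bool using (true)
import Data.Bool as Bool
open import Data.Maybe using (Maybe; just; nothing; Is-just; to-witness; _>>=_)
import Data.Maybe as Maybe
open import Data.Maybe.Relation.Unary.Any using (just)
open import Data.Sum using (_⊎_; inj₁; inj₂)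
open import Data.Unit using (tt)
open import Data.Empty using (⊥; ⊥-elim)
open import Data.Product using (Σ; ∃; _×_; _,_; proj₁; proj₂)
open import Relation.Nullary using (¬_; Dec; yes; no; does)
open import Relation.Binary.PropositionalEquality
  using (_≡_; _≢_; refl; sym; trans; cong; subst; ≡-≟-identity)

step? : ∀ {L : Set} (T : TS L) s e t → Dec (Step T s e t)
step? T s e t = TS.trans T s e t Bool.≟ true

successor? : ∀ {L : Set} (T : TS L) s e → Dec (∃ λ t → Step T s e t)
successor? T s e = any? (step? T s e)

masking-loop : ∀ {k} (A : TS (Fin k)) s → Step (A ᴹ) s Mlab s
masking-loop A s = cong does (≡-≟-identity _≟_ {s} refl)

module Game {k f : ℕ} (A : TS (Fin k)) (A' : TS (Fin k ⊎ Fin f)) where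
  open MaskingGame A A'

  Move : Node → Set
  Move n = Σ GLabel λ l → Σ Node λ m → Edge n l m

  target : ∀ {n} → Move n → Node
  target (_ , m , _) = m

  edge : ∀ {n} (mv : Move n) → Edge n (proj₁ mv) (target mv)
  edge (_ , _ , e) = e

  some-letter : Fin k
  some-letter = proj₁ (TS.total A (TS.init A))

  to-err : ∀ {n} → (∀ l m → ¬ BaseEdge n l m) → Move n
  to-err none = lab (inj₁ some-letter) , err , inj₂ (none , refl , some-letter , refl)

  outgoing : ∀ n → Move n
  outgoing (rN s s') =
    let e , t , s→t = TS.total A s in lab (inj₁ e) , _ , inj₁ (r1 {s' = s'} s→t)
  outgoing (vN s (inj₁ e) one s') with successor? A' s' (inj₁ e)
  ... | yes (t' , s'→t') = lab (inj₁ e) , rN s t' , inj₁ (v1 s'→t')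
  ... | no stuck = to-err λ { _ _ (v1 s'→t') → stuck (_ , s'→t') }
  outgoing (vN s (inj₁ e) two s') with successor? A s e
  ... | yes (t , s→t) = lab (inj₁ e) , rN t s' , inj₁ (v2 s→t)
  ... | no stuck = to-err λ { _ _ (v2 s→t) → stuck (_ , s→t) }
  outgoing (vN s (inj₂ F) one s') = to-err λ _ _ ()
  outgoing (vN s (inj₂ F) two s') = mask , rN s s' , inj₁ (vM (masking-loop A s))
  outgoing err = to-err λ _ _ ()

  module FromSimulation (R : State A → State A' → Set) (sim : MaskingSimRel A A' R) where

    SafeAnswer : Node → Set
    SafeAnswer n =
      Σ GLabel λ l → Σ (State A) λ t → Σ (State A') λ t' → BaseEdge n l (rN t t') × R t t'

    Tracked : Node → Set
    Tracked (rN s s')         = R s s'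
    Tracked (vN s σ side s')  = SafeAnswer (vN s σ side s')
    Tracked err               = ⊥

    -- Clauses (B1)-(B3): every refuter move from an R-related node has a
    -- safe answer, and no refuter move leads to s_err.
    respond : ∀ {s s' l m} → R s s' → Edge (rN s s') l m → Tracked m
    respond {s} {s'} r (inj₁ (r1 {e = e} {t = t} s→t)) =
      let t' , s'→t' , r' = proj₁ (proj₂ sim s s' r) e t s→t
      in lab (inj₁ e) , t , t' , v1 s'→t' , r'
    respond {s} {s'} r (inj₁ (r2 {σ = inj₁ e} {t' = t'} s'→t')) =
      let t , s→t , r' = proj₁ (proj₂ (proj₂ sim s s' r)) e t' s'→t'
      in lab (inj₁ e) , t , t' , v2 s→t , r'
    respond {s} {s'} r (inj₁ (r2 {σ = inj₂ F} {t' = t'} s'→t')) =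
      let t , s→t , r' = proj₂ (proj₂ (proj₂ sim s s' r)) F t' s'→t'
      in mask , t , t' , vM s→t , r'
    respond {s} r (inj₂ (no-base , _)) =
      let e , t , s→t = TS.total A s in ⊥-elim (no-base _ _ (r1 s→t))

    arrive : ∀ {n} → SafeAnswer n → (m : Node) → Maybe (Tracked m)
    arrive (_ , t , t' , _ , r) (rN u u') with t ≟ u | t' ≟ u'
    ... | yes refl | yes refl = just r
    ... | _        | _        = nothing
    arrive _ (vN _ _ _ _) = nothing
    arrive _ err          = nothing

    arrive-at-target : ∀ {n} (ans@(_ , t , t' , _) : SafeAnswer n) → Is-just (arrive ans (rN t t'))
    arrive-at-target (_ , t , t' , _) with t ≟ t | t' ≟ t'
    ... | yes refl | yes refl = just tt
    ... | no t≢t   | _        = ⊥-elim (t≢t refl)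
    ... | yes _    | no t'≢t' = ⊥-elim (t'≢t' refl)

    track : ∀ {n} → Prefix n → Maybe (Tracked n)
    track start                           = just (proj₁ sim)
    track (step {rN _ _} p e)             = Maybe.map (λ r → respond r e) (track p)
    track (step {vN _ _ _ _} {m = m} p e) = track p >>= λ ans → arrive ans m
    track (step {err} p e)                = nothing

    -- Play the tracked safe answer; without evidence (which never happens in
    -- a conforming play) play any move.
    choose : ∀ {n} → IsVerifier n → Maybe (Tracked n) → Move n
    choose {rN _ _} ()
    choose {err} ()
    choose {vN _ _ _ _} _ (just (l , t , t' , b , _)) = l , rN t t' , inj₁ b
    choose {n} _ nothing = outgoing n

    strategy : VStrategy
    strategy p v = choose v (track p)

    tracked-not-err : ∀ {n} (p : Prefix n) → Is-just (track p) → n ≢ err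
    tracked-not-err p tracked refl = to-witness tracked

    stays-tracked : ∀ {n l m} (p : Prefix n) (e : Edge n l m) → Is-just (track p) →
                    ((v : IsVerifier n) → target (strategy p v) ≡ m) →
                    Is-just (track (step p e))
    stays-tracked {rN _ _} p e tracked _ with track p
    stays-tracked {rN _ _} p e _  _ | just r  = just tt
    stays-tracked {rN _ _} p e () _ | nothing
    stays-tracked {vN _ _ _ _} p e tracked chosen with track p | chosen tt
    ... | just ans | refl = arrive-at-target ans
    stays-tracked {err} p e tracked _ = ⊥-elim (tracked-not-err p tracked refl)

    initially-tracked : ∀ {n} (n≡init : n ≡ initNode) → Is-just (track (subst Prefix (sym n≡init) start))
    initially-tracked refl = just tt

    winning : WinningV strategy
    winning P conforms i = tracked-not-err (prefixOf P i) (tracked i)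
      where
      tracked : ∀ i → Is-just (track (prefixOf P i))
      tracked zero    = initially-tracked (Play.first P)
      tracked (suc i) = stays-tracked (prefixOf P i) (Play.edge P i) (tracked i)
                                      (λ v → proj₂ (conforms i v))

  module FromStrategy (σ : VStrategy) where

    Agrees : ∀ {n l m} → Prefix n → Edge n l m → Set
    Agrees {n} {l} {m} p e = (v : IsVerifier n) → proj₁ (σ p v) ≡ l × target (σ p v) ≡ m

    infix 4 _⇝_
    infixr 5 _∷_
    data _⇝_ : ∀ {m n} → Prefix m → Prefix n → Set where
      done : ∀ {n} {p : Prefix n} → p ⇝ p
      _∷_  : ∀ {m l m' n} {q : Prefix m} {e : Edge m l m'} {p : Prefix n} →
             Agrees q e → step q e ⇝ p → q ⇝ p

    ⇝-snoc : ∀ {m n l n'} {q : Prefix m} {p : Prefix n} {e : Edge n l n'} →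
             q ⇝ p → Agrees p e → q ⇝ step p e
    ⇝-snoc done       agrees = agrees ∷ done
    ⇝-snoc (a ∷ rest) agrees = a ∷ ⇝-snoc rest agrees

    -- σ does not constrain the refuter.
    ⇝-refuter : ∀ {m s s' l n} {q : Prefix m} {p : Prefix (rN s s')} →
                q ⇝ p → (e : Edge (rN s s') l n) → q ⇝ step p e
    ⇝-refuter route e = ⇝-snoc route λ ()

    continue : ∀ {m} → Prefix m → Move m
    continue {vN _ _ _ _} q = σ q tt
    continue {rN s s'}    q = outgoing (rN s s')
    continue {err}        q = outgoing err

    continue-agrees : ∀ {m} (q : Prefix m) → Agrees q (edge (continue q))
    continue-agrees {vN _ _ _ _} q _ = refl , refl
    continue-agrees {rN _ _}     q ()
    continue-agrees {err}        q ()

    -- Replaying a route from start to goal and then continuing with σ gives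
    -- a play conforming to σ that visits the end node of goal.
    module Replay {n} (goal : Prefix n) where

      -- A position of the replay: the prefix played so far and what is left
      -- of the route to goal (nothing once goal has been passed).
      data Position : Set where
        _▸_ : ∀ {m} (q : Prefix m) → Maybe (q ⇝ goal) → Position

      node : Position → Node
      node (_▸_ {m} _ _) = m

      prefix : (x : Position) → Prefix (node x)
      prefix (q ▸ _) = q

      Advance : Position → Set
      Advance x = Σ GLabel λ l → Σ Position λ y → Edge (node x) l (node y)

      continue-from : ∀ {m} (q : Prefix m) → Advance (q ▸ nothing)
      continue-from q = proj₁ (continue q) , (step q (edge (continue q)) ▸ nothing) , edge (continue q)

      advance : (x : Position) → Advance x
      advance (q ▸ just (_∷_ {e = e} _ rest)) = _ , (step q e ▸ just rest) , e
      advance (q ▸ just done)                 = continue-from q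
      advance (q ▸ nothing)                   = continue-from q

      next : Position → Position
      next x = proj₁ (proj₂ (advance x))

      advance-prefix : (x : Position) → prefix (next x) ≡ step (prefix x) (proj₂ (proj₂ (advance x)))
      advance-prefix (q ▸ just (_ ∷ _)) = refl
      advance-prefix (q ▸ just done)    = refl
      advance-prefix (q ▸ nothing)      = refl

      advance-agrees : (x : Position) → Agrees (prefix x) (proj₂ (proj₂ (advance x)))
      advance-agrees (q ▸ just (agrees ∷ _)) = agrees
      advance-agrees (q ▸ just done)         = continue-agrees q
      advance-agrees (q ▸ nothing)           = continue-agrees q

      reaches-goal : ∀ {m} {q : Prefix m} (route : q ⇝ goal) →
                     Σ ℕ λ j → node (iterate next (q ▸ just route) j) ≡ n
      reaches-goal done       = 0 , refl
      reaches-goal (_ ∷ rest) = let j , reached = reaches-goal rest in suc j , reached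

      positions : start ⇝ goal → ℕ → Position
      positions route = fold (start ▸ just route) next

      play : start ⇝ goal → Play
      play route = record
        { node  = λ i → node (positions route i)
        ; label = λ i → proj₁ (advance (positions route i))
        ; first = refl
        ; edge  = λ i → proj₂ (proj₂ (advance (positions route i)))
        }

      prefix-of-play : ∀ route i → prefixOf (play route) i ≡ prefix (positions route i)
      prefix-of-play route zero    = refl
      prefix-of-play route (suc i) =
        trans (cong (λ q → step q (Play.edge (play route) i)) (prefix-of-play route i))
              (sym (advance-prefix (positions route i)))

      play-conforms : ∀ route → ConformsTo σ (play route)
      play-conforms route i rewrite prefix-of-play route i = advance-agrees (positions route i)

      play-visits-goal : ∀ route → Σ ℕ λ j → Play.node (play route) j ≡ n
      play-visits-goal route =
        let j , reached = reaches-goal route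
        in j , trans (cong node (iterate-is-fold (start ▸ just route) next j)) reached

    reachable-not-err : WinningV σ → ∀ {n} {p : Prefix n} → start ⇝ p → n ≢ err
    reachable-not-err winning {p = p} route n≡err =
      let open Replay p
          j , visits = play-visits-goal route
      in winning (play route) (play-conforms route) j (trans visits n≡err)

    answer : WinningV σ → ∀ {n} {p : Prefix n} → start ⇝ p → IsVerifier n →
             Σ GLabel λ l → Σ Node λ m → Σ (BaseEdge n l m) λ b → start ⇝ step p (inj₁ b)
    answer winning {rN _ _} _ ()
    answer winning {err}    _ ()
    answer winning {vN _ _ _ _} {p} route tt =
      base-edge (edge (σ p tt)) (⇝-snoc route λ _ → refl , refl)
      where
      base-edge : ∀ {l m} (e : Edge _ l m) → start ⇝ step p e →
                  Σ GLabel λ l → Σ Node λ m → Σ (BaseEdge _ l m) λ b → start ⇝ step p (inj₁ b)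
      base-edge (inj₁ b)             route' = _ , _ , b , route'
      base-edge (inj₂ (_ , refl , _)) route' = ⊥-elim (reachable-not-err winning route' refl)

    Reachable : State A → State A' → Set
    Reachable s s' = Σ (Prefix (rN s s')) λ p → start ⇝ p

    reachable-simulation : WinningV σ → MaskingSimRel A A' Reachable
    reachable-simulation winning = (start , done) , λ s s' r → forth r , back r , masking r
      where
      forth : ∀ {s s'} → Reachable s s' → ∀ e t → Step A s e t →
              Σ (State A') λ t' → Step A' s' (inj₁ e) t' × Reachable t t'
      forth (p , route) e t s→t with answer winning (⇝-refuter route (inj₁ (r1 s→t))) tt
      ... | _ , _ , v1 s'→t' , route' = _ , s'→t' , _ , route'

      back : ∀ {s s'} → Reachable s s' → ∀ e t' → Step A' s' (inj₁ e) t' →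
             Σ (State A) λ t → Step A s e t × Reachable t t'
      back (p , route) e t' s'→t' with answer winning (⇝-refuter route (inj₁ (r2 s'→t'))) tt
      ... | _ , _ , v2 s→t , route' = _ , s→t , _ , route'

      masking : ∀ {s s'} → Reachable s s' → ∀ F t' → Step A' s' (inj₂ F) t' →
                Σ (State (A ᴹ)) λ t → Step (A ᴹ) s Mlab t × Reachable t t'
      masking (p , route) F t' s'→t' with answer winning (⇝-refuter route (inj₁ (r2 s'→t'))) tt
      ... | _ , _ , vM s→t , route' = _ , s→t , _ , route'

  simulation⇒winning : A ⪯ₘ A' → VerifierWins A A'
  simulation⇒winning (R , sim) = strategy , winning
    where open FromSimulation R sim

  winning⇒simulation : VerifierWins A A' → A ⪯ₘ A'
  winning⇒simulation (σ , winning) = Reachable , reachable-simulation winning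
    where open FromStrategy σ

theorem3 : (k f : ℕ) (A : TS (Fin k)) (A' : TS (Fin k ⊎ Fin f)) →
    (A ⪯ₘ A' → VerifierWins A A') × (VerifierWins A A' → A ⪯ₘ A')
theorem3 k f A A' = simulation⇒winning , winning⇒simulation
  where open Game A A'
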